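{- Let $\Omega$ be a succession rule with ECO matrix $F=(f_{nk})_{n,k\geq1}$, and let $a_{nk}$ be defined by $\sum_{k=1}^n f_{nk}x^k=\sum_{k=1}^n a_{nk}p_k(x)$ for $n\geq1$. Then for every $n\geq 1$, \[ a_{(n+1)n}=f_{(n+1)n}+n\,f_{(n+1)(n+1)}. \]
   Context: A succession rule has an axiom $(a)$ and productions $(k)\rightsquigarrow(e_1(k))\cdots(e_k(k))$ with positive integer labels; its generating tree has root (level $0$) labelled $a$, and each node labelled $k$ has $k$ children labelled $e_1(k),\dots,e_k(k)$. Standing assumption: the labels are exactly $\{1,2,\dots\}$ and the largest label produced by $(k)$ is $(k+1)$. The ECO matrix has $f_{nk}$ = number of nodes labelled $k$ at level $n-1$ of the generating tree, so $f_{nk}=0$ for $k>n$. The Aigner basis is $p_0=1$, $p_n(x)=x(x-1)^{n-1}$ ($n\geq1$). -}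

module Defs where

open import Data.Nat using (ℕ; zero; suc; _≟_)
open import Data.Fin using (Fin)
open import Data.List using (List; []; _∷_; map; concatMap; allFin; filter; length)
open import Data.Integer as ℤ using (ℤ)

record SuccessionRule : Set where
  field
    axiom : ℕ
    prod  : (k : ℕ) → Fin k → ℕ

open SuccessionRule public

children : SuccessionRule → ℕ → List ℕ
children Ω k = map (prod Ω k) (allFin k)

-- multiset (as a list) of labels at level m of the generating tree
level : SuccessionRule → ℕ → List ℕ
level Ω zero    = axiom Ω ∷ []
level Ω (suc m) = concatMap (children Ω) (level Ω m)

-- ECO matrix: f n k = number of nodes labelled k at level n-1  (n ≥ 1);
-- the unused row n = 0 is set to 0.
eco : SuccessionRule → ℕ → ℕ → ℕ
eco Ω zero    k = 0
eco Ω (suc n) k = length (filter (_≟ k) (level Ω n))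

sum1 : ℕ → (ℕ → ℤ) → ℤ
sum1 zero    g = ℤ.0ℤ
sum1 (suc n) g = sum1 n g ℤ.+ g (suc n)

aigner : ℕ → ℤ → ℤ
aigner zero    x = ℤ.1ℤ
aigner (suc n) x = x ℤ.* ((x ℤ.- ℤ.1ℤ) ℤ.^ n)

{-# OPTIONS --safe #-}

-- Both sides of the defining identity for row n + 1 are integer polynomials that agree at every
-- positive integer, hence have the same coefficients: a polynomial vanishing at all positive
-- integers is zero, because its constant term is divisible by every positive integer. The k-th
-- monomial and the k-th Aigner polynomial are both monic of degree k, so comparing coefficients
-- of x^(n+1) gives a_(n+1)(n+1) = f_(n+1)(n+1); comparing those of x^n, to which x (x - 1)^n
-- contributes -n, gives f_(n+1)n = a_(n+1)n - n a_(n+1)(n+1).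

module Submission where

open import Defs
open import Data.Nat using (ℕ; suc; _≤_; _<_; _≥_)
open import Data.Fin using (Fin)
open import Data.Product using (_×_; Σ; ∃)
open import Data.Integer as ℤ using (ℤ; +_)
open import Relation.Binary.PropositionalEquality using (_≡_)

open import Data.Nat using (zero; z≤n; s≤s; s≤s⁻¹)
open import Data.Nat.Properties as ℕₚ using (≤-refl; <⇒≤; m<n⇒m<1+n)
open import Data.Nat.Divisibility as ℕ∣ using (>⇒∤)
open import Data.Integer using (0ℤ; 1ℤ; -1ℤ; _+_; _*_; -_; _-_; _^_; ∣_∣)
open import Data.Integer.Properties
  using (+-identityˡ; +-identityʳ; *-identityʳ; *-zeroʳ; -1*i≡-i; i*j≡0⇒i≡0∨j≡0; ∣i∣≡0⇒i≡0; i≡j⇒i-j≡0; i-j≡0⇒i≡j)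
open import Data.Integer.Divisibility.Signed using (_∣_; divides; ∣-refl; ∣⇒∣ᵤ; ∣m⇒∣m*n; ∣m+n∣n⇒∣m)
open import Data.Integer.Tactic.RingSolver using (solve-∀)
open import Data.List using (List; []; _∷_; map)
open import Data.Sum using (inj₂)
open import Relation.Nullary using (contradiction)
open import Relation.Binary.PropositionalEquality using (refl; sym; trans; cong; cong₂; subst; module ≡-Reasoning)
open ≡-Reasoning

-- Polynomials over ℤ as coefficient lists, constant term first.
Poly : Set
Poly = List ℤ

eval : Poly → ℤ → ℤ
eval []      x = 0ℤ
eval (c ∷ p) x = c + x * eval p x

coeff : Poly → ℕ → ℤ
coeff []      j       = 0ℤ
coeff (c ∷ p) zero    = c
coeff (c ∷ p) (suc j) = coeff p j

Degree≤ : Poly → ℕ → Set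
Degree≤ p n = ∀ {j} → n < j → coeff p j ≡ 0ℤ

infixl 6 _+ₚ_ _-ₚ_
infixr 7 _·ₚ_

_+ₚ_ : Poly → Poly → Poly
[]      +ₚ q       = q
(a ∷ p) +ₚ []      = a ∷ p
(a ∷ p) +ₚ (b ∷ q) = a + b ∷ p +ₚ q

_·ₚ_ : ℤ → Poly → Poly
c ·ₚ p = map (c *_) p

_-ₚ_ : Poly → Poly → Poly
p -ₚ q = p +ₚ -1ℤ ·ₚ q

X·_ : Poly → Poly
X· p = 0ℤ ∷ p

eval-+ₚ : ∀ p q x → eval (p +ₚ q) x ≡ eval p x + eval q x
eval-+ₚ []      q       x = sym (+-identityˡ _)
eval-+ₚ (a ∷ p) []      x = sym (+-identityʳ _)
eval-+ₚ (a ∷ p) (b ∷ q) x = begin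
  a + b + x * eval (p +ₚ q) x        ≡⟨ cong (λ e → a + b + x * e) (eval-+ₚ p q x) ⟩
  a + b + x * (eval p x + eval q x)  ≡⟨ distrib a b x (eval p x) (eval q x) ⟩
  a + x * eval p x + (b + x * eval q x) ∎
  where
  distrib : ∀ a b x u v → a + b + x * (u + v) ≡ a + x * u + (b + x * v)
  distrib = solve-∀

eval-·ₚ : ∀ c p x → eval (c ·ₚ p) x ≡ c * eval p x
eval-·ₚ c []      x = sym (*-zeroʳ c)
eval-·ₚ c (a ∷ p) x = begin
  c * a + x * eval (c ·ₚ p) x  ≡⟨ cong (λ e → c * a + x * e) (eval-·ₚ c p x) ⟩
  c * a + x * (c * eval p x)   ≡⟨ distrib c a x (eval p x) ⟩
  c * (a + x * eval p x)       ∎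
  where
  distrib : ∀ c a x u → c * a + x * (c * u) ≡ c * (a + x * u)
  distrib = solve-∀

eval--ₚ : ∀ p q x → eval (p -ₚ q) x ≡ eval p x - eval q x
eval--ₚ p q x = begin
  eval (p -ₚ q) x                   ≡⟨ eval-+ₚ p (-1ℤ ·ₚ q) x ⟩
  eval p x + eval (-1ℤ ·ₚ q) x      ≡⟨ cong (λ e → eval p x + e) (trans (eval-·ₚ -1ℤ q x) (-1*i≡-i _)) ⟩
  eval p x - eval q x               ∎

eval-X· : ∀ p x → eval (X· p) x ≡ x * eval p x
eval-X· p x = +-identityˡ _

coeff-+ₚ : ∀ p q j → coeff (p +ₚ q) j ≡ coeff p j + coeff q j
coeff-+ₚ []      q       j       = sym (+-identityˡ _)
coeff-+ₚ (a ∷ p) []      j       = sym (+-identityʳ _)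
coeff-+ₚ (a ∷ p) (b ∷ q) zero    = refl
coeff-+ₚ (a ∷ p) (b ∷ q) (suc j) = coeff-+ₚ p q j

coeff-·ₚ : ∀ c p j → coeff (c ·ₚ p) j ≡ c * coeff p j
coeff-·ₚ c []      j       = sym (*-zeroʳ c)
coeff-·ₚ c (a ∷ p) zero    = refl
coeff-·ₚ c (a ∷ p) (suc j) = coeff-·ₚ c p j

coeff--ₚ : ∀ p q j → coeff (p -ₚ q) j ≡ coeff p j - coeff q j
coeff--ₚ p q j = begin
  coeff (p -ₚ q) j               ≡⟨ coeff-+ₚ p (-1ℤ ·ₚ q) j ⟩
  coeff p j + coeff (-1ℤ ·ₚ q) j ≡⟨ cong (λ e → coeff p j + e) (trans (coeff-·ₚ -1ℤ q j) (-1*i≡-i _)) ⟩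
  coeff p j - coeff q j          ∎

divisible-by-all-positive⇒≡0 : ∀ n → (∀ t → suc t ℕ∣.∣ n) → n ≡ 0
divisible-by-all-positive⇒≡0 zero    _          = refl
divisible-by-all-positive⇒≡0 (suc n) all-divide = contradiction (all-divide (suc n)) (>⇒∤ ≤-refl)

-- Evaluating at x = t + 1 shows that every t + 1 divides the constant term.
vanishes-on-positives⇒coeff≡0 : ∀ p → (∀ t → eval p (+ suc t) ≡ 0ℤ) → ∀ j → coeff p j ≡ 0ℤ
vanishes-on-positives⇒coeff≡0 []      _        j       = refl
vanishes-on-positives⇒coeff≡0 (c ∷ p) vanishes zero    = c≡0
  where
  x∣c : ∀ t → + suc t ∣ c
  x∣c t = ∣m+n∣n⇒∣m (subst (+ suc t ∣_) (sym (vanishes t)) (divides 0ℤ refl))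
                    (∣m⇒∣m*n (eval p (+ suc t)) ∣-refl)
  c≡0 : c ≡ 0ℤ
  c≡0 = ∣i∣≡0⇒i≡0 (divisible-by-all-positive⇒≡0 ∣ c ∣ (λ t → ∣⇒∣ᵤ (x∣c t)))
vanishes-on-positives⇒coeff≡0 (c ∷ p) vanishes (suc j) =
  vanishes-on-positives⇒coeff≡0 p tail-vanishes j
  where
  c≡0 : c ≡ 0ℤ
  c≡0 = vanishes-on-positives⇒coeff≡0 (c ∷ p) vanishes zero
  tail-vanishes : ∀ t → eval p (+ suc t) ≡ 0ℤ
  tail-vanishes t with i*j≡0⇒i≡0∨j≡0 (+ suc t) (begin
    + suc t * eval p (+ suc t)       ≡⟨ +-identityˡ _ ⟨
    0ℤ + + suc t * eval p (+ suc t)  ≡⟨ cong (λ d → d + + suc t * eval p (+ suc t)) c≡0 ⟨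
    c + + suc t * eval p (+ suc t)   ≡⟨ vanishes t ⟩
    0ℤ                               ∎)
  ... | inj₂ tail≡0 = tail≡0

agree-on-positives⇒coeff≡ : ∀ p q → (∀ t → eval p (+ suc t) ≡ eval q (+ suc t)) →
                            ∀ j → coeff p j ≡ coeff q j
agree-on-positives⇒coeff≡ p q agree j = i-j≡0⇒i≡j _ _ (begin
  coeff p j - coeff q j  ≡⟨ coeff--ₚ p q j ⟨
  coeff (p -ₚ q) j       ≡⟨ vanishes-on-positives⇒coeff≡0 (p -ₚ q) difference-vanishes j ⟩
  0ℤ                     ∎)
  where
  difference-vanishes : ∀ t → eval (p -ₚ q) (+ suc t) ≡ 0ℤ
  difference-vanishes t = trans (eval--ₚ p q (+ suc t)) (i≡j⇒i-j≡0 (agree t))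

X^_ : ℕ → Poly
X^ zero  = 1ℤ ∷ []
X^ suc k = X· X^ k

eval-X^ : ∀ k x → eval (X^ k) x ≡ x ^ k
eval-X^ zero    x = cong (λ e → 1ℤ + e) (*-zeroʳ x)
eval-X^ (suc k) x = trans (eval-X· (X^ k) x) (cong (x *_) (eval-X^ k x))

degree-X^ : ∀ k → Degree≤ (X^ k) k
degree-X^ zero    {suc j} _   = refl
degree-X^ (suc k) {suc j} k<j = degree-X^ k (s≤s⁻¹ k<j)

coeff-X^-self : ∀ k → coeff (X^ k) k ≡ 1ℤ
coeff-X^-self zero    = refl
coeff-X^-self (suc k) = coeff-X^-self k

coeff-X^-below : ∀ {j k} → j < k → coeff (X^ k) j ≡ 0ℤ
coeff-X^-below {zero}  {suc k} _   = refl
coeff-X^-below {suc j} {suc k} j<k = coeff-X^-below (s≤s⁻¹ j<k)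

[X-1]^_ : ℕ → Poly
[X-1]^ zero  = 1ℤ ∷ []
[X-1]^ suc k = X· [X-1]^ k -ₚ [X-1]^ k

eval-[X-1]^ : ∀ k x → eval ([X-1]^ k) x ≡ (x - 1ℤ) ^ k
eval-[X-1]^ zero    x = cong (λ e → 1ℤ + e) (*-zeroʳ x)
eval-[X-1]^ (suc k) x = begin
  eval (X· [X-1]^ k -ₚ [X-1]^ k) x             ≡⟨ eval--ₚ (X· [X-1]^ k) ([X-1]^ k) x ⟩
  eval (X· [X-1]^ k) x - eval ([X-1]^ k) x     ≡⟨ cong (_- eval ([X-1]^ k) x) (eval-X· ([X-1]^ k) x) ⟩
  x * eval ([X-1]^ k) x - eval ([X-1]^ k) x    ≡⟨ factor x (eval ([X-1]^ k) x) ⟩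
  (x - 1ℤ) * eval ([X-1]^ k) x                 ≡⟨ cong ((x - 1ℤ) *_) (eval-[X-1]^ k x) ⟩
  (x - 1ℤ) * (x - 1ℤ) ^ k                      ∎
  where
  factor : ∀ x u → x * u - u ≡ (x - 1ℤ) * u
  factor = solve-∀

degree-[X-1]^ : ∀ k → Degree≤ ([X-1]^ k) k
degree-[X-1]^ zero    {suc j} _   = refl
degree-[X-1]^ (suc k) {suc j} k<j = begin
  coeff (X· [X-1]^ k -ₚ [X-1]^ k) (suc j)   ≡⟨ coeff--ₚ (X· [X-1]^ k) ([X-1]^ k) (suc j) ⟩
  coeff ([X-1]^ k) j - coeff ([X-1]^ k) (suc j)
    ≡⟨ cong₂ _-_ (degree-[X-1]^ k (s≤s⁻¹ k<j)) (degree-[X-1]^ k (m<n⇒m<1+n (s≤s⁻¹ k<j))) ⟩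
  0ℤ                                        ∎

coeff-[X-1]^-self : ∀ k → coeff ([X-1]^ k) k ≡ 1ℤ
coeff-[X-1]^-self zero    = refl
coeff-[X-1]^-self (suc k) = begin
  coeff (X· [X-1]^ k -ₚ [X-1]^ k) (suc k)        ≡⟨ coeff--ₚ (X· [X-1]^ k) ([X-1]^ k) (suc k) ⟩
  coeff ([X-1]^ k) k - coeff ([X-1]^ k) (suc k)  ≡⟨ cong₂ _-_ (coeff-[X-1]^-self k) (degree-[X-1]^ k ≤-refl) ⟩
  1ℤ                                             ∎

coeff-[X-1]^-subleading : ∀ k → coeff ([X-1]^ suc k) k ≡ - + suc k
coeff-[X-1]^-subleading zero    = refl
coeff-[X-1]^-subleading (suc k) = begin
  coeff (X· [X-1]^ suc k -ₚ [X-1]^ suc k) (suc k)        ≡⟨ coeff--ₚ (X· [X-1]^ suc k) ([X-1]^ suc k) (suc k) ⟩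
  coeff ([X-1]^ suc k) k - coeff ([X-1]^ suc k) (suc k)
    ≡⟨ cong₂ _-_ (coeff-[X-1]^-subleading k) (coeff-[X-1]^-self (suc k)) ⟩
  - + suc k - 1ℤ                                         ≡⟨ cong ℤ.-[1+_] (cong suc (ℕₚ.+-identityʳ k)) ⟩
  - + suc (suc k)                                        ∎

aignerₚ : ℕ → Poly
aignerₚ zero    = 1ℤ ∷ []
aignerₚ (suc k) = X· [X-1]^ k

eval-aignerₚ : ∀ k x → eval (aignerₚ k) x ≡ aigner k x
eval-aignerₚ zero    x = cong (λ e → 1ℤ + e) (*-zeroʳ x)
eval-aignerₚ (suc k) x = trans (eval-X· ([X-1]^ k) x) (cong (x *_) (eval-[X-1]^ k x))

degree-aignerₚ : ∀ k → Degree≤ (aignerₚ k) k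
degree-aignerₚ zero    {suc j} _   = refl
degree-aignerₚ (suc k) {suc j} k<j = degree-[X-1]^ k (s≤s⁻¹ k<j)

coeff-aignerₚ-self : ∀ k → coeff (aignerₚ k) k ≡ 1ℤ
coeff-aignerₚ-self zero    = refl
coeff-aignerₚ-self (suc k) = coeff-[X-1]^-self k

lincomb : ℕ → (ℕ → ℤ) → (ℕ → Poly) → Poly
lincomb zero    c P = []
lincomb (suc n) c P = lincomb n c P +ₚ c (suc n) ·ₚ P (suc n)

eval-lincomb : ∀ n c P x {g : ℕ → ℤ} → (∀ k → eval (P k) x ≡ g k) →
               eval (lincomb n c P) x ≡ sum1 n (λ k → c k * g k)
eval-lincomb zero    c P x         eval-P = refl
eval-lincomb (suc n) c P x {g} eval-P = begin
  eval (lincomb n c P +ₚ c (suc n) ·ₚ P (suc n)) x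
    ≡⟨ eval-+ₚ (lincomb n c P) (c (suc n) ·ₚ P (suc n)) x ⟩
  eval (lincomb n c P) x + eval (c (suc n) ·ₚ P (suc n)) x
    ≡⟨ cong₂ _+_ (eval-lincomb n c P x eval-P)
                 (trans (eval-·ₚ (c (suc n)) (P (suc n)) x) (cong (c (suc n) *_) (eval-P (suc n)))) ⟩
  sum1 n (λ k → c k * g k) + c (suc n) * g (suc n)
    ∎

coeff-lincomb-step : ∀ n c P j →
  coeff (lincomb (suc n) c P) j ≡ coeff (lincomb n c P) j + c (suc n) * coeff (P (suc n)) j
coeff-lincomb-step n c P j =
  trans (coeff-+ₚ (lincomb n c P) (c (suc n) ·ₚ P (suc n)) j)
        (cong (λ e → coeff (lincomb n c P) j + e) (coeff-·ₚ (c (suc n)) (P (suc n)) j))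

module _ {P : ℕ → Poly} (degree-P : ∀ k → Degree≤ (P k) k) (monic-P : ∀ k → coeff (P k) k ≡ 1ℤ)
         (c : ℕ → ℤ) where

  degree-lincomb : ∀ n → Degree≤ (lincomb n c P) n
  degree-lincomb zero    _   = refl
  degree-lincomb (suc n) {j} n<j = begin
    coeff (lincomb (suc n) c P) j                              ≡⟨ coeff-lincomb-step n c P j ⟩
    coeff (lincomb n c P) j + c (suc n) * coeff (P (suc n)) j
      ≡⟨ cong₂ (λ d e → d + c (suc n) * e) (degree-lincomb n (<⇒≤ n<j)) (degree-P (suc n) n<j) ⟩
    0ℤ + c (suc n) * 0ℤ                                        ≡⟨ +-identityˡ _ ⟩
    c (suc n) * 0ℤ                                             ≡⟨ *-zeroʳ (c (suc n)) ⟩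
    0ℤ                                                         ∎

  coeff-lincomb-leading : ∀ n → coeff (lincomb (suc n) c P) (suc n) ≡ c (suc n)
  coeff-lincomb-leading n = begin
    coeff (lincomb (suc n) c P) (suc n)                        ≡⟨ coeff-lincomb-step n c P (suc n) ⟩
    coeff (lincomb n c P) (suc n) + c (suc n) * coeff (P (suc n)) (suc n)
      ≡⟨ cong₂ (λ d e → d + c (suc n) * e) (degree-lincomb n ≤-refl) (monic-P (suc n)) ⟩
    0ℤ + c (suc n) * 1ℤ                                        ≡⟨ +-identityˡ _ ⟩
    c (suc n) * 1ℤ                                             ≡⟨ *-identityʳ (c (suc n)) ⟩
    c (suc n)                                                  ∎

  coeff-lincomb-subleading : ∀ n → coeff (lincomb (suc (suc n)) c P) (suc n)
                                   ≡ c (suc n) + c (suc (suc n)) * coeff (P (suc (suc n))) (suc n)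
  coeff-lincomb-subleading n =
    trans (coeff-lincomb-step (suc n) c P (suc n))
          (cong (λ d → d + c (suc (suc n)) * coeff (P (suc (suc n))) (suc n)) (coeff-lincomb-leading n))

i+j*0≡k+j*-n⇒k≡i+n*j : ∀ i j k n → i + j * 0ℤ ≡ k + j * - n → k ≡ i + n * j
i+j*0≡k+j*-n⇒k≡i+n*j i j k n eq = begin
  k                       ≡⟨ add-and-cancel k j n ⟩
  k + j * - n + n * j     ≡⟨ cong (λ e → e + n * j) eq ⟨
  i + j * 0ℤ + n * j      ≡⟨ drop-zero i j n ⟩
  i + n * j               ∎
  where
  add-and-cancel : ∀ k j n → k ≡ k + j * - n + n * j
  add-and-cancel = solve-∀
  drop-zero : ∀ i j n → i + j * 0ℤ + n * j ≡ i + n * j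
  drop-zero = solve-∀

mainTheorem7 : (Ω : SuccessionRule)
    → 1 ≤ axiom Ω
    → (∀ k (i : Fin k) → 1 ≤ prod Ω k i × prod Ω k i ≤ suc k)
    → (∀ k → k ≥ 1 → Σ (Fin k) (λ i → prod Ω k i ≡ suc k))
    → (∀ k → k ≥ 1 → ∃ (λ n → n ≥ 1 × 1 ≤ eco Ω n k))
    → (∀ n k → n ≥ 1 → n < k → eco Ω n k ≡ 0)
    → (a : ℕ → ℕ → ℤ)
    → (∀ n → n ≥ 1 → ∀ (x : ℤ) →
         sum1 n (λ k → + eco Ω n k ℤ.* (x ℤ.^ k)) ≡ sum1 n (λ k → a n k ℤ.* aigner k x))
    → ∀ n → n ≥ 1 →
      a (suc n) n ≡ + eco Ω (suc n) n ℤ.+ (+ n) ℤ.* (+ eco Ω (suc n) (suc n))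
mainTheorem7 Ω _ _ _ _ _ a expansion n@(suc m) _ =
  i+j*0≡k+j*-n⇒k≡i+n*j (f n) (f N) (a N n) (+ n) (begin
    f n + f N * 0ℤ                       ≡⟨ cong (λ e → f n + f N * e) (coeff-X^-below {n} {N} ≤-refl) ⟨
    f n + f N * coeff (X^ N) n           ≡⟨ coeff-lincomb-subleading degree-X^ coeff-X^-self f m ⟨
    coeff (lincomb N f X^_) n            ≡⟨ same-coeff n ⟩
    coeff (lincomb N (a N) aignerₚ) n    ≡⟨ coeff-lincomb-subleading degree-aignerₚ coeff-aignerₚ-self (a N) m ⟩
    a N n + a N N * coeff (aignerₚ N) n  ≡⟨ cong₂ (λ d e → a N n + d * e) (sym leading) (coeff-[X-1]^-subleading m) ⟩
    a N n + f N * - + n                  ∎)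
  where
  N : ℕ
  N = suc n
  f : ℕ → ℤ
  f k = + eco Ω N k
  same-coeff : ∀ j → coeff (lincomb N f X^_) j ≡ coeff (lincomb N (a N) aignerₚ) j
  same-coeff = agree-on-positives⇒coeff≡ (lincomb N f X^_) (lincomb N (a N) aignerₚ) agree
    where
    agree : ∀ t → eval (lincomb N f X^_) (+ suc t) ≡ eval (lincomb N (a N) aignerₚ) (+ suc t)
    agree t = begin
      eval (lincomb N f X^_) x             ≡⟨ eval-lincomb N f X^_ x (λ k → eval-X^ k x) ⟩
      sum1 N (λ k → f k * x ^ k)           ≡⟨ expansion N (s≤s z≤n) x ⟩
      sum1 N (λ k → a N k * aigner k x)    ≡⟨ eval-lincomb N (a N) aignerₚ x (λ k → eval-aignerₚ k x) ⟨
      eval (lincomb N (a N) aignerₚ) x     ∎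
      where
      x : ℤ
      x = + suc t
  leading : f N ≡ a N N
  leading = begin
    f N                                  ≡⟨ coeff-lincomb-leading degree-X^ coeff-X^-self f n ⟨
    coeff (lincomb N f X^_) N            ≡⟨ same-coeff N ⟩
    coeff (lincomb N (a N) aignerₚ) N    ≡⟨ coeff-lincomb-leading degree-aignerₚ coeff-aignerₚ-self (a N) n ⟩
    a N N                                ∎
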